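{- Let $p,q$ be integers with $p\neq 0$, $q\neq 0$ and $\Delta=p^2-4q\neq 0$. Let $k\geq 2$ and $m\geq 1$ be integers. Then: (i) $\displaystyle\sum_{t=0}^{k-1}\binom{k-1}{t}(-p)^{ -t}U_{mk+t}^{(k)}=\left(\frac{q}{p}\right)^{k-1}U_{m}\,U_{(m-1)(k-1)}^{(k-1)}$; (ii) $\displaystyle\sum_{t=0}^{k-1}\binom{k-1}{t}\left(\frac{ -p}{q}\right)^{t}U_{mk+t}^{(k)}=(-q)^{1-k}U_{m}\,U_{(m+2)(k-1)}^{(k-1)}$; (iii) if moreover $U_{m-1}\neq 0$, then $\displaystyle\sum_{t=0}^{k-1}p^{ -t}U_{mk+t}^{(k)}=\left(-\frac{p}{q}\right)p^{ -k}\left(\frac{U_{m}}{U_{m-1}}\right)\left(U_{(m+1)k}^{(k)}-p^{k}U_{mk}^{(k)}\right)$.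
   Context: For integers $p,q$, the sequence $(U_n)_{n\geq 0}$ is defined by $U_0=0$, $U_1=1$, $U_n=pU_{n-1}-qU_{n-2}$ for $n\geq 2$. Let $\alpha=\frac{p+\sqrt{\Delta}}{2}$, $\beta=\frac{p-\sqrt{\Delta}}{2}$ with $\Delta=p^2-4q$; when $\Delta\neq0$ one has $U_n=\frac{\alpha^n-\beta^n}{\alpha-\beta}$. For an integer $k\geq 1$ and an integer $n\geq 0$, write uniquely $n=mk+r$ with $m\geq 0$ and $0\leq r<k$, and define the generalized Fibonacci number $U_n^{(k)}=\frac{1}{(\alpha-\beta)^k}(\alpha^{m+1}-\beta^{m+1})^{r}(\alpha^{m}-\beta^{m})^{k-r}$; equivalently $U_{mk+r}^{(k)}=U_m^{k-r}U_{m+1}^{r}$. -}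

module Defs where

open import Data.Nat as ℕ using (ℕ; zero; suc; _∸_)
open import Data.Nat.DivMod using (_/_; _%_)
open import Data.Integer as ℤ using (ℤ)
open import Data.Rational as ℚ using (ℚ; 0ℚ; 1ℚ; _+_; _*_; 1/_; ≢-nonZero)
open import Data.Rational.Properties using (_≟_)
open import Relation.Nullary using (yes; no)

U : ℤ → ℤ → ℕ → ℤ
U p q zero = ℤ.0ℤ
U p q (suc zero) = ℤ.1ℤ
U p q (suc (suc n)) = p ℤ.* U p q (suc n) ℤ.- q ℤ.* U p q n

-- Generalized Fibonacci number U^{(k)}_n = U_m^{k-r} U_{m+1}^r where n = m k + r, 0 ≤ r < k.
-- (Only meaningful for k ≥ 1; the value at k = 0 is an arbitrary convention and never used.)
UG : ℤ → ℤ → ℕ → ℕ → ℤ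
UG p q zero n = ℤ.0ℤ
UG p q k@(suc _) n = (U p q (n / k) ℤ.^ (k ∸ (n % k))) ℤ.* (U p q (suc (n / k)) ℤ.^ (n % k))

⟦_⟧ : ℤ → ℚ
⟦ z ⟧ = z ℚ./ 1

-- total multiplicative inverse on ℚ (inv 0 = 0); only applied to nonzero arguments below
inv : ℚ → ℚ
inv x with x ≟ 0ℚ
... | yes _ = 0ℚ
... | no x≢0 = 1/_ x {{≢-nonZero x≢0}}

_^ℚ_ : ℚ → ℕ → ℚ
x ^ℚ zero = 1ℚ
x ^ℚ suc n = x * (x ^ℚ n)

Σ< : ℕ → (ℕ → ℚ) → ℚ
Σ< zero f = 0ℚ
Σ< (suc n) f = Σ< n f + f n

-- Write a = U_m and b = U_{m+1}. On the block mk ≤ n < (m+1)k the generalized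
-- Fibonacci numbers are monomials, U^{(k)}_{mk+t} = a^{k-t} b^t, so after pulling
-- out one factor a the sums (i) and (ii) are binomial expansions of (a + r b)^{k-1}
-- with r = -1/p and r = -p/q, while (iii) is a geometric sum with ratio b/(pa).
-- The recurrence collapses the resulting bases:
--   a - b/p = (q/p) U_{m-1}   and   a - (p/q) b = -U_{m+2}/q,
-- and in (iii) the geometric sum is divided by the first of them, whence U_{m-1} ≠ 0.
module Submission where

open import Defs
open import Data.Nat as ℕ using (ℕ; zero; suc; _∸_; _≤_; _<_; z≤n; s≤s)
import Data.Nat.Properties as ℕ
open import Data.Nat.DivMod using (_/_; _%_; +-distrib-/-∣ˡ; m*n/n≡m; m<n⇒m/n≡0; %-remove-+ˡ; m<n⇒m%n≡m)
open import Data.Nat.Divisibility using (n∣m*n)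
open import Data.Nat.Combinatorics using (_C_)
open import Data.Nat.Coprimality as Coprime using (1-coprimeTo)
open import Data.Integer as ℤ using (ℤ)
import Data.Integer.Properties as ℤ
open import Data.Rational as ℚ using (ℚ; mkℚ; _+_; _*_; -_; _-_; 0ℚ; 1ℚ; 1/_; ↥_)
open import Data.Rational.Properties
  using ( _≟_; ↥p/↧p≡p; neg-injective; 1≢0; +-*-commutativeRing; +-inverseʳ
        ; *-assoc; *-identityˡ; *-identityʳ; *-zeroˡ; *-zeroʳ; *-inverseˡ; *-inverseʳ
        ; *-distribˡ-+; *-distribʳ-+ )
open import Data.Fin using (toℕ; fromℕ; inject₁)
open import Data.Fin.Properties using (toℕ-inject₁; toℕ-fromℕ)
open import Data.Product using (_×_; _,_)
open import Data.Empty using (⊥-elim)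
open import Relation.Nullary using (yes; no)
open import Relation.Nullary.Decidable using (dec⇒maybe)
open import Relation.Binary.PropositionalEquality
open ≡-Reasoning

open import Algebra.Bundles using (CommutativeRing)
open CommutativeRing +-*-commutativeRing using (commutativeSemiring; +-monoid; +-rawMonoid)
open import Algebra.Properties.CommutativeSemiring.Exp commutativeSemiring using (_^_; ^-distrib-*)
open import Algebra.Properties.Monoid.Sum +-monoid using (sum-syntax; sum-init-last; sum-cong-≗)
open import Algebra.Definitions.RawMonoid +-rawMonoid using () renaming (_×_ to _·_)
import Algebra.Properties.CommutativeSemiring.Binomial commutativeSemiring as Binomial
open import Tactic.RingSolver using (solve-∀)
open import Tactic.RingSolver.Core.AlmostCommutativeRing using (AlmostCommutativeRing; fromCommutativeRing)

-- solve-∀ only proves closed, universally quantified equations; local ring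
-- identities below are therefore stated in that form and then instantiated.
ℚ-ring : AlmostCommutativeRing _ _
ℚ-ring = fromCommutativeRing +-*-commutativeRing (λ x → dec⇒maybe (0ℚ ≟ x))

-- ⟦ z ⟧ = z / 1 goes through normalisation; `integer z` is the same rational
-- written as a record, on which _+_ and _*_ compute.
integer : ℤ → ℚ
integer z = mkℚ z 0 (Coprime.sym (1-coprimeTo _))

⟦⟧≡integer : ∀ z → ⟦ z ⟧ ≡ integer z
⟦⟧≡integer z = ↥p/↧p≡p (integer z)

⟦⟧-homo-+ : ∀ a b → ⟦ a ℤ.+ b ⟧ ≡ ⟦ a ⟧ + ⟦ b ⟧
⟦⟧-homo-+ a b = begin
  ⟦ a ℤ.+ b ⟧                       ≡⟨ cong ⟦_⟧ (cong₂ ℤ._+_ (ℤ.*-identityʳ a) (ℤ.*-identityʳ b)) ⟨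
  ⟦ a ℤ.* ℤ.+ 1 ℤ.+ b ℤ.* ℤ.+ 1 ⟧   ≡⟨⟩
  integer a + integer b             ≡⟨ cong₂ _+_ (⟦⟧≡integer a) (⟦⟧≡integer b) ⟨
  ⟦ a ⟧ + ⟦ b ⟧                     ∎

⟦⟧-homo-* : ∀ a b → ⟦ a ℤ.* b ⟧ ≡ ⟦ a ⟧ * ⟦ b ⟧
⟦⟧-homo-* a b = sym (cong₂ _*_ (⟦⟧≡integer a) (⟦⟧≡integer b))

⟦⟧-homo‿- : ∀ a → ⟦ ℤ.- a ⟧ ≡ - ⟦ a ⟧
⟦⟧-homo‿- a = trans (⟦⟧≡integer (ℤ.- a)) (trans (integer-homo‿- a) (cong -_ (sym (⟦⟧≡integer a))))
  where
  integer-homo‿- : ∀ a → integer (ℤ.- a) ≡ - integer a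
  integer-homo‿- ℤ.+0       = refl
  integer-homo‿- ℤ.+[1+ _ ] = refl
  integer-homo‿- ℤ.-[1+ _ ] = refl

⟦⟧-homo-^ : ∀ z n → ⟦ z ℤ.^ n ⟧ ≡ ⟦ z ⟧ ^ℚ n
⟦⟧-homo-^ z zero    = refl
⟦⟧-homo-^ z (suc n) = trans (⟦⟧-homo-* z (z ℤ.^ n)) (cong (⟦ z ⟧ *_) (⟦⟧-homo-^ z n))

⟦⟧-≢0 : ∀ {z} → z ≢ ℤ.0ℤ → ⟦ z ⟧ ≢ 0ℚ
⟦⟧-≢0 {z} z≢0 ⟦z⟧≡0 = z≢0 (cong ↥_ (trans (sym (⟦⟧≡integer z)) ⟦z⟧≡0))

⟦+⟧-*≡· : ∀ n x → ⟦ ℤ.+ n ⟧ * x ≡ n · x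
⟦+⟧-*≡· zero    x = *-zeroˡ x
⟦+⟧-*≡· (suc n) x = begin
  ⟦ ℤ.1ℤ ℤ.+ ℤ.+ n ⟧ * x    ≡⟨ cong (_* x) (⟦⟧-homo-+ ℤ.1ℤ (ℤ.+ n)) ⟩
  (1ℚ + ⟦ ℤ.+ n ⟧) * x      ≡⟨ *-distribʳ-+ x 1ℚ ⟦ ℤ.+ n ⟧ ⟩
  1ℚ * x + ⟦ ℤ.+ n ⟧ * x    ≡⟨ cong (_+ ⟦ ℤ.+ n ⟧ * x) (*-identityˡ x) ⟩
  x + ⟦ ℤ.+ n ⟧ * x         ≡⟨ cong (x +_) (⟦+⟧-*≡· n x) ⟩
  x + n · x                 ∎

^ℚ≡^ : ∀ x n → x ^ℚ n ≡ x ^ n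
^ℚ≡^ x zero    = refl
^ℚ≡^ x (suc n) = cong (x *_) (^ℚ≡^ x n)

^ℚ-distrib-* : ∀ x y n → (x * y) ^ℚ n ≡ x ^ℚ n * y ^ℚ n
^ℚ-distrib-* x y n = begin
  (x * y) ^ℚ n       ≡⟨ ^ℚ≡^ (x * y) n ⟩
  (x * y) ^ n        ≡⟨ ^-distrib-* x y n ⟩
  x ^ n * y ^ n      ≡⟨ cong₂ _*_ (^ℚ≡^ x n) (^ℚ≡^ y n) ⟨
  x ^ℚ n * y ^ℚ n    ∎

1ℚ^ℚ : ∀ n → 1ℚ ^ℚ n ≡ 1ℚ
1ℚ^ℚ zero    = refl
1ℚ^ℚ (suc n) = cong (1ℚ *_) (1ℚ^ℚ n)

^ℚ-inverse : ∀ {x y} n → y * x ≡ 1ℚ → y ^ℚ n * x ^ℚ n ≡ 1ℚ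
^ℚ-inverse {x} {y} n y*x≡1 = begin
  y ^ℚ n * x ^ℚ n    ≡⟨ ^ℚ-distrib-* y x n ⟨
  (y * x) ^ℚ n       ≡⟨ cong (_^ℚ n) y*x≡1 ⟩
  1ℚ ^ℚ n            ≡⟨ 1ℚ^ℚ n ⟩
  1ℚ                 ∎

inv-inverseˡ : ∀ {x} → x ≢ 0ℚ → inv x * x ≡ 1ℚ
inv-inverseˡ {x} x≢0 with x ≟ 0ℚ
... | yes x≡0  = ⊥-elim (x≢0 x≡0)
... | no  x≢0′ = *-inverseˡ x {{ℚ.≢-nonZero x≢0′}}

inv-unique : ∀ {x y} → y * x ≡ 1ℚ → inv x ≡ y
inv-unique {x} {y} y*x≡1 with x ≟ 0ℚ
... | yes refl = ⊥-elim (1≢0 (trans (sym y*x≡1) (*-zeroʳ y)))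
... | no  x≢0  = begin
  1/ x                ≡⟨ *-identityˡ (1/ x) ⟨
  1ℚ * 1/ x           ≡⟨ cong (_* 1/ x) y*x≡1 ⟨
  y * x * 1/ x        ≡⟨ *-assoc y x (1/ x) ⟩
  y * (x * 1/ x)      ≡⟨ cong (y *_) (*-inverseʳ x) ⟩
  y * 1ℚ              ≡⟨ *-identityʳ y ⟩
  y                   ∎
  where instance _ = ℚ.≢-nonZero x≢0

inv-^ : ∀ {x} n → x ≢ 0ℚ → inv (x ^ℚ n) ≡ inv x ^ℚ n
inv-^ n x≢0 = inv-unique (^ℚ-inverse n (inv-inverseˡ x≢0))

inv-neg : ∀ {x} → x ≢ 0ℚ → inv (- x) ≡ - inv x
inv-neg {x} x≢0 = inv-unique (trans (-x*-y≡x*y (inv x) x) (inv-inverseˡ x≢0))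
  where
  -x*-y≡x*y : ∀ x y → (- x) * (- y) ≡ x * y
  -x*-y≡x*y = solve-∀ ℚ-ring

inv-⟦-⟧^ : ∀ {z} t → z ≢ ℤ.0ℤ → inv (⟦ ℤ.- z ⟧ ^ℚ t) ≡ (- inv ⟦ z ⟧) ^ℚ t
inv-⟦-⟧^ {z} t z≢0 = begin
  inv (⟦ ℤ.- z ⟧ ^ℚ t)     ≡⟨ cong (λ x → inv (x ^ℚ t)) (⟦⟧-homo‿- z) ⟩
  inv ((- ⟦ z ⟧) ^ℚ t)     ≡⟨ inv-^ t (λ -⟦z⟧≡0 → ⟦⟧-≢0 z≢0 (neg-injective -⟦z⟧≡0)) ⟩
  inv (- ⟦ z ⟧) ^ℚ t       ≡⟨ cong (_^ℚ t) (inv-neg (⟦⟧-≢0 z≢0)) ⟩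
  (- inv ⟦ z ⟧) ^ℚ t       ∎

-- Identities that hold only because some product e = x⁻¹ x equals 1 are proved
-- as ring identities carrying a correction term (1 - e) * y, removed by this lemma.
absorb-unit : ∀ {e} x y → e ≡ 1ℚ → x + (1ℚ - e) * y ≡ x
absorb-unit x y refl = x+[1-1]*y≡x x y
  where
  x+[1-1]*y≡x : ∀ x y → x + (1ℚ - 1ℚ) * y ≡ x
  x+[1-1]*y≡x = solve-∀ ℚ-ring

*-inverse-move : ∀ {x d y e} → x * d ≡ y → d * e ≡ 1ℚ → x ≡ y * e
*-inverse-move {x} {d} {y} {e} x*d≡y d*e≡1 = begin
  x              ≡⟨ *-identityʳ x ⟨
  x * 1ℚ         ≡⟨ cong (x *_) d*e≡1 ⟨
  x * (d * e)    ≡⟨ *-assoc x d e ⟨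
  x * d * e      ≡⟨ cong (_* e) x*d≡y ⟩
  y * e          ∎

Σ<-cong : ∀ n {f g : ℕ → ℚ} → (∀ t → t < n → f t ≡ g t) → Σ< n f ≡ Σ< n g
Σ<-cong zero    f≗g = refl
Σ<-cong (suc n) f≗g = cong₂ _+_ (Σ<-cong n (λ t t<n → f≗g t (ℕ.m<n⇒m<1+n t<n))) (f≗g n ℕ.≤-refl)

*-distribˡ-Σ< : ∀ n x f → x * Σ< n f ≡ Σ< n (λ t → x * f t)
*-distribˡ-Σ< zero    x f = *-zeroʳ x
*-distribˡ-Σ< (suc n) x f = trans (*-distribˡ-+ x (Σ< n f) (f n)) (cong (_+ x * f n) (*-distribˡ-Σ< n x f))

*-distribʳ-Σ< : ∀ n f x → Σ< n f * x ≡ Σ< n (λ t → f t * x)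
*-distribʳ-Σ< zero    f x = *-zeroˡ x
*-distribʳ-Σ< (suc n) f x = trans (*-distribʳ-+ x (Σ< n f) (f n)) (cong (_+ f n * x) (*-distribʳ-Σ< n f x))

Σ<-telescope : ∀ n (g : ℕ → ℚ) → Σ< n (λ t → g t - g (suc t)) ≡ g 0 - g n
Σ<-telescope zero    g = sym (+-inverseʳ (g 0))
Σ<-telescope (suc n) g = trans (cong (_+ (g n - g (suc n))) (Σ<-telescope n g)) ([a-b]+[b-c]≡a-c (g 0) (g n) (g (suc n)))
  where
  [a-b]+[b-c]≡a-c : ∀ a b c → (a - b) + (b - c) ≡ a - c
  [a-b]+[b-c]≡a-c = solve-∀ ℚ-ring

Σ<≡∑ : ∀ n f → Σ< n f ≡ ∑[ i < n ] f (toℕ i)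
Σ<≡∑ zero    f = refl
Σ<≡∑ (suc n) f = begin
  Σ< n f + f n                                         ≡⟨ cong₂ _+_ (Σ<≡∑ n f) (cong f (sym (toℕ-fromℕ n))) ⟩
  ∑[ i < n ] f (toℕ i) + f (toℕ (fromℕ n))             ≡⟨ cong (_+ f (toℕ (fromℕ n))) (sum-cong-≗ {n} (λ i → cong f (toℕ-inject₁ i))) ⟨
  ∑[ i < n ] f (toℕ (inject₁ i)) + f (toℕ (fromℕ n))   ≡⟨ sum-init-last {n} (λ i → f (toℕ i)) ⟨
  ∑[ i < suc n ] f (toℕ i)                             ∎

Σ<-binomial : ∀ n x y → Σ< (suc n) (λ t → ⟦ ℤ.+ (n C t) ⟧ * (x ^ℚ t * y ^ℚ (n ∸ t))) ≡ (x + y) ^ℚ n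
Σ<-binomial n x y = begin
  Σ< (suc n) (λ t → ⟦ ℤ.+ (n C t) ⟧ * (x ^ℚ t * y ^ℚ (n ∸ t)))
    ≡⟨ Σ<-cong (suc n) (λ t _ → ⟦+⟧-*≡· (n C t) _) ⟩
  Σ< (suc n) (λ t → (n C t) · (x ^ℚ t * y ^ℚ (n ∸ t)))
    ≡⟨ Σ<-cong (suc n) (λ t _ → cong ((n C t) ·_) (cong₂ _*_ (^ℚ≡^ x t) (^ℚ≡^ y (n ∸ t)))) ⟩
  Σ< (suc n) (λ t → (n C t) · (x ^ t * y ^ (n ∸ t)))
    ≡⟨ Σ<≡∑ (suc n) _ ⟩
  Binomial.binomialExpansion x y n
    ≡⟨ Binomial.theorem n x y ⟨
  (x + y) ^ n
    ≡⟨ ^ℚ≡^ (x + y) n ⟨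
  (x + y) ^ℚ n
    ∎

Σ<-geometric : ∀ k x y → Σ< k (λ t → x ^ℚ (k ∸ t) * y ^ℚ t) * (x - y) ≡ x * (x ^ℚ k - y ^ℚ k)
Σ<-geometric k x y = begin
  Σ< k (λ t → x ^ℚ (k ∸ t) * y ^ℚ t) * (x - y)      ≡⟨ *-distribʳ-Σ< k _ (x - y) ⟩
  Σ< k (λ t → x ^ℚ (k ∸ t) * y ^ℚ t * (x - y))      ≡⟨ Σ<-cong k step ⟩
  Σ< k (λ t → g t - g (suc t))                       ≡⟨ Σ<-telescope k g ⟩
  g 0 - g k                                          ≡⟨ cong (λ e → g 0 - x ^ℚ e * y ^ℚ k) (ℕ.m+n∸n≡m 1 k) ⟩
  x * x ^ℚ k * 1ℚ - x * 1ℚ * y ^ℚ k                  ≡⟨ factor x (x ^ℚ k) (y ^ℚ k) ⟩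
  x * (x ^ℚ k - y ^ℚ k)                              ∎
  where
  g : ℕ → ℚ
  g t = x ^ℚ (suc k ∸ t) * y ^ℚ t
  split : ∀ x y a b → a * b * (x - y) ≡ x * a * b - a * (y * b)
  split = solve-∀ ℚ-ring
  factor : ∀ x a b → x * a * 1ℚ - x * 1ℚ * b ≡ x * (a - b)
  factor = solve-∀ ℚ-ring
  step : ∀ t → t < k → x ^ℚ (k ∸ t) * y ^ℚ t * (x - y) ≡ g t - g (suc t)
  step t t<k rewrite ℕ.+-∸-assoc 1 (ℕ.<⇒≤ t<k) = split x y (x ^ℚ (k ∸ t)) (y ^ℚ t)

[m*n+t]/n≡m : ∀ m n t .{{_ : ℕ.NonZero n}} → t < n → (m ℕ.* n ℕ.+ t) / n ≡ m
[m*n+t]/n≡m m n t t<n = begin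
  (m ℕ.* n ℕ.+ t) / n      ≡⟨ +-distrib-/-∣ˡ t (n∣m*n m) ⟩
  m ℕ.* n / n ℕ.+ t / n    ≡⟨ cong₂ ℕ._+_ (m*n/n≡m m n) (m<n⇒m/n≡0 t<n) ⟩
  m ℕ.+ 0                  ≡⟨ ℕ.+-identityʳ m ⟩
  m                        ∎

[m*n+t]%n≡t : ∀ m n t .{{_ : ℕ.NonZero n}} → t < n → (m ℕ.* n ℕ.+ t) % n ≡ t
[m*n+t]%n≡t m n t t<n = trans (%-remove-+ˡ t (n∣m*n m)) (m<n⇒m%n≡m t<n)

UG-block : ∀ p q n m t → t < suc n →
           UG p q (suc n) (m ℕ.* suc n ℕ.+ t) ≡ U p q m ℤ.^ (suc n ∸ t) ℤ.* U p q (suc m) ℤ.^ t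
UG-block p q n m t t<k rewrite [m*n+t]/n≡m m (suc n) t t<k | [m*n+t]%n≡t m (suc n) t t<k = refl

module _ (p q : ℤ) where

  P Q : ℚ
  P = ⟦ p ⟧
  Q = ⟦ q ⟧

  u : ℕ → ℚ
  u n = ⟦ U p q n ⟧

  u-rec : ∀ n → u (suc (suc n)) ≡ P * u (suc n) - Q * u n
  u-rec n = begin
    ⟦ p ℤ.* U p q (suc n) ℤ.- q ℤ.* U p q n ⟧
      ≡⟨ ⟦⟧-homo-+ (p ℤ.* U p q (suc n)) (ℤ.- (q ℤ.* U p q n)) ⟩
    ⟦ p ℤ.* U p q (suc n) ⟧ + ⟦ ℤ.- (q ℤ.* U p q n) ⟧
      ≡⟨ cong₂ _+_ (⟦⟧-homo-* p (U p q (suc n))) (⟦⟧-homo‿- (q ℤ.* U p q n)) ⟩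
    P * u (suc n) - ⟦ q ℤ.* U p q n ⟧
      ≡⟨ cong (λ e → P * u (suc n) - e) (⟦⟧-homo-* q (U p q n)) ⟩
    P * u (suc n) - Q * u n
      ∎

  u-descend : ∀ {iP} m → iP * P ≡ 1ℚ → u (suc m) - iP * u (suc (suc m)) ≡ Q * iP * u m
  u-descend {iP} m iP*P≡1 = begin
    u (suc m) - iP * u (suc (suc m))               ≡⟨ cong (λ e → u (suc m) - iP * e) (u-rec m) ⟩
    u (suc m) - iP * (P * u (suc m) - Q * u m)     ≡⟨ expand iP P Q (u (suc m)) (u m) ⟩
    Q * iP * u m + (1ℚ - iP * P) * u (suc m)       ≡⟨ absorb-unit (Q * iP * u m) (u (suc m)) iP*P≡1 ⟩
    Q * iP * u m                                   ∎
    where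
    expand : ∀ iP P Q a c → a - iP * (P * a - Q * c) ≡ Q * iP * c + (1ℚ - iP * P) * a
    expand = solve-∀ ℚ-ring

  u-ascend : ∀ {iQ} m → iQ * Q ≡ 1ℚ → u (suc m) - P * iQ * u (suc (suc m)) ≡ (- iQ) * u (suc (suc (suc m)))
  u-ascend {iQ} m iQ*Q≡1 = begin
    u (suc m) - P * iQ * u (suc (suc m))
      ≡⟨ expand iQ P Q (u (suc m)) (u (suc (suc m))) ⟩
    (- iQ) * (P * u (suc (suc m)) - Q * u (suc m)) + (1ℚ - iQ * Q) * u (suc m)
      ≡⟨ absorb-unit _ (u (suc m)) iQ*Q≡1 ⟩
    (- iQ) * (P * u (suc (suc m)) - Q * u (suc m))
      ≡⟨ cong ((- iQ) *_) (u-rec (suc m)) ⟨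
    (- iQ) * u (suc (suc (suc m)))
      ∎
    where
    expand : ∀ iQ P Q a b → a - P * iQ * b ≡ (- iQ) * (P * b - Q * a) + (1ℚ - iQ * Q) * a
    expand = solve-∀ ℚ-ring

  ⟦UG⟧-block : ∀ n m t → t < suc n →
               ⟦ UG p q (suc n) (m ℕ.* suc n ℕ.+ t) ⟧ ≡ u m ^ℚ (suc n ∸ t) * u (suc m) ^ℚ t
  ⟦UG⟧-block n m t t<k = begin
    ⟦ UG p q (suc n) (m ℕ.* suc n ℕ.+ t) ⟧
      ≡⟨ cong ⟦_⟧ (UG-block p q n m t t<k) ⟩
    ⟦ U p q m ℤ.^ (suc n ∸ t) ℤ.* U p q (suc m) ℤ.^ t ⟧
      ≡⟨ ⟦⟧-homo-* (U p q m ℤ.^ (suc n ∸ t)) (U p q (suc m) ℤ.^ t) ⟩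
    ⟦ U p q m ℤ.^ (suc n ∸ t) ⟧ * ⟦ U p q (suc m) ℤ.^ t ⟧
      ≡⟨ cong₂ _*_ (⟦⟧-homo-^ (U p q m) (suc n ∸ t)) (⟦⟧-homo-^ (U p q (suc m)) t) ⟩
    u m ^ℚ (suc n ∸ t) * u (suc m) ^ℚ t
      ∎

  ⟦UG⟧-multiple : ∀ n m → ⟦ UG p q (suc n) (m ℕ.* suc n) ⟧ ≡ u m ^ℚ suc n
  ⟦UG⟧-multiple n m = begin
    ⟦ UG p q (suc n) (m ℕ.* suc n) ⟧         ≡⟨ cong (λ i → ⟦ UG p q (suc n) i ⟧) (ℕ.+-identityʳ (m ℕ.* suc n)) ⟨
    ⟦ UG p q (suc n) (m ℕ.* suc n ℕ.+ 0) ⟧   ≡⟨ ⟦UG⟧-block n m 0 (s≤s z≤n) ⟩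
    u m ^ℚ suc n * 1ℚ                        ≡⟨ *-identityʳ (u m ^ℚ suc n) ⟩
    u m ^ℚ suc n                             ∎

  Σ<-binomial-UG : ∀ n m r →
    Σ< (suc n) (λ t → ⟦ ℤ.+ (n C t) ⟧ * r ^ℚ t * ⟦ UG p q (suc n) (m ℕ.* suc n ℕ.+ t) ⟧)
      ≡ u m * (r * u (suc m) + u m) ^ℚ n
  Σ<-binomial-UG n m r = begin
    Σ< (suc n) (λ t → coeff t * r ^ℚ t * UGₜ t)                         ≡⟨ Σ<-cong (suc n) term ⟩
    Σ< (suc n) (λ t → a * (coeff t * ((r * b) ^ℚ t * a ^ℚ (n ∸ t))))   ≡⟨ *-distribˡ-Σ< (suc n) a _ ⟨
    a * Σ< (suc n) (λ t → coeff t * ((r * b) ^ℚ t * a ^ℚ (n ∸ t)))     ≡⟨ cong (a *_) (Σ<-binomial n (r * b) a) ⟩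
    a * (r * b + a) ^ℚ n                                               ∎
    where
    a = u m
    b = u (suc m)
    coeff UGₜ : ℕ → ℚ
    coeff t = ⟦ ℤ.+ (n C t) ⟧
    UGₜ t = ⟦ UG p q (suc n) (m ℕ.* suc n ℕ.+ t) ⟧
    rearrange : ∀ c s a x y → c * s * (a * x * y) ≡ a * (c * (s * y * x))
    rearrange = solve-∀ ℚ-ring
    term : ∀ t → t < suc n → coeff t * r ^ℚ t * UGₜ t ≡ a * (coeff t * ((r * b) ^ℚ t * a ^ℚ (n ∸ t)))
    term t t<k@(s≤s t≤n) = begin
      coeff t * r ^ℚ t * UGₜ t
        ≡⟨ cong (coeff t * r ^ℚ t *_) (⟦UG⟧-block n m t t<k) ⟩
      coeff t * r ^ℚ t * (a ^ℚ (suc n ∸ t) * b ^ℚ t)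
        ≡⟨ cong (λ e → coeff t * r ^ℚ t * (a ^ℚ e * b ^ℚ t)) (ℕ.+-∸-assoc 1 t≤n) ⟩
      coeff t * r ^ℚ t * (a * a ^ℚ (n ∸ t) * b ^ℚ t)
        ≡⟨ rearrange (coeff t) (r ^ℚ t) a (a ^ℚ (n ∸ t)) (b ^ℚ t) ⟩
      a * (coeff t * (r ^ℚ t * b ^ℚ t * a ^ℚ (n ∸ t)))
        ≡⟨ cong (λ e → a * (coeff t * (e * a ^ℚ (n ∸ t)))) (^ℚ-distrib-* r b t) ⟨
      a * (coeff t * ((r * b) ^ℚ t * a ^ℚ (n ∸ t)))
        ∎

  Σ<-geometric-UG : ∀ n m r → let k = suc n in
    Σ< k (λ t → r ^ℚ t * ⟦ UG p q k (m ℕ.* k ℕ.+ t) ⟧) * (u m - r * u (suc m))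
      ≡ u m * (u m ^ℚ k - (r * u (suc m)) ^ℚ k)
  Σ<-geometric-UG n m r = begin
    Σ< k (λ t → r ^ℚ t * UGₜ t) * (a - r * b)                  ≡⟨ cong (_* (a - r * b)) (Σ<-cong k term) ⟩
    Σ< k (λ t → a ^ℚ (k ∸ t) * (r * b) ^ℚ t) * (a - r * b)     ≡⟨ Σ<-geometric k a (r * b) ⟩
    a * (a ^ℚ k - (r * b) ^ℚ k)                                ∎
    where
    k = suc n
    a = u m
    b = u (suc m)
    UGₜ : ℕ → ℚ
    UGₜ t = ⟦ UG p q k (m ℕ.* k ℕ.+ t) ⟧
    swap : ∀ x y z → x * (y * z) ≡ y * (x * z)
    swap = solve-∀ ℚ-ring
    term : ∀ t → t < k → r ^ℚ t * UGₜ t ≡ a ^ℚ (k ∸ t) * (r * b) ^ℚ t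
    term t t<k = begin
      r ^ℚ t * UGₜ t                        ≡⟨ cong (r ^ℚ t *_) (⟦UG⟧-block n m t t<k) ⟩
      r ^ℚ t * (a ^ℚ (k ∸ t) * b ^ℚ t)      ≡⟨ swap (r ^ℚ t) (a ^ℚ (k ∸ t)) (b ^ℚ t) ⟩
      a ^ℚ (k ∸ t) * (r ^ℚ t * b ^ℚ t)      ≡⟨ cong (a ^ℚ (k ∸ t) *_) (^ℚ-distrib-* r b t) ⟨
      a ^ℚ (k ∸ t) * (r * b) ^ℚ t           ∎

  -- The three identities, with k = n + 1 and the paper's m equal to m + 1 here.

  identity-i : ∀ j m → p ≢ ℤ.0ℤ → let n = suc j in
    Σ< (suc n) (λ t → ⟦ ℤ.+ (n C t) ⟧ * inv (⟦ ℤ.- p ⟧ ^ℚ t) * ⟦ UG p q (suc n) (suc m ℕ.* suc n ℕ.+ t) ⟧)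
      ≡ (Q * inv P) ^ℚ n * u (suc m) * ⟦ UG p q n (m ℕ.* n) ⟧
  identity-i j m p≢0 = begin
    Σ< (suc n) (λ t → coeff t * inv (⟦ ℤ.- p ⟧ ^ℚ t) * UGₜ t)
      ≡⟨ Σ<-cong (suc n) (λ t _ → cong (λ e → coeff t * e * UGₜ t) (inv-⟦-⟧^ t p≢0)) ⟩
    Σ< (suc n) (λ t → coeff t * (- iP) ^ℚ t * UGₜ t)
      ≡⟨ Σ<-binomial-UG n (suc m) (- iP) ⟩
    a * ((- iP) * b + a) ^ℚ n
      ≡⟨ cong (λ e → a * e ^ℚ n) (trans (-x*b+a≡a-x*b iP b a) (u-descend m (inv-inverseˡ (⟦⟧-≢0 p≢0)))) ⟩
    a * (Q * iP * c) ^ℚ n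
      ≡⟨ cong (a *_) (^ℚ-distrib-* (Q * iP) c n) ⟩
    a * ((Q * iP) ^ℚ n * c ^ℚ n)
      ≡⟨ rearrange a ((Q * iP) ^ℚ n) (c ^ℚ n) ⟩
    (Q * iP) ^ℚ n * a * c ^ℚ n
      ≡⟨ cong ((Q * iP) ^ℚ n * a *_) (⟦UG⟧-multiple j m) ⟨
    (Q * iP) ^ℚ n * a * ⟦ UG p q n (m ℕ.* n) ⟧
      ∎
    where
    n = suc j
    a = u (suc m)
    b = u (suc (suc m))
    c = u m
    iP = inv P
    coeff UGₜ : ℕ → ℚ
    coeff t = ⟦ ℤ.+ (n C t) ⟧
    UGₜ t = ⟦ UG p q (suc n) (suc m ℕ.* suc n ℕ.+ t) ⟧
    -x*b+a≡a-x*b : ∀ x b a → (- x) * b + a ≡ a - x * b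
    -x*b+a≡a-x*b = solve-∀ ℚ-ring
    rearrange : ∀ a x y → a * (x * y) ≡ x * a * y
    rearrange = solve-∀ ℚ-ring

  identity-ii : ∀ j m → q ≢ ℤ.0ℤ → let n = suc j in
    Σ< (suc n) (λ t → ⟦ ℤ.+ (n C t) ⟧ * (⟦ ℤ.- p ⟧ * inv Q) ^ℚ t * ⟦ UG p q (suc n) (suc m ℕ.* suc n ℕ.+ t) ⟧)
      ≡ inv (⟦ ℤ.- q ⟧ ^ℚ n) * u (suc m) * ⟦ UG p q n ((suc m ℕ.+ 2) ℕ.* n) ⟧
  identity-ii j m q≢0 = begin
    Σ< (suc n) (λ t → ⟦ ℤ.+ (n C t) ⟧ * r ^ℚ t * ⟦ UG p q (suc n) (suc m ℕ.* suc n ℕ.+ t) ⟧)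
      ≡⟨ Σ<-binomial-UG n (suc m) r ⟩
    a * (r * b + a) ^ℚ n
      ≡⟨ cong (λ e → a * e ^ℚ n) r*b+a≡-iQ*d ⟩
    a * ((- iQ) * d) ^ℚ n
      ≡⟨ cong (a *_) (^ℚ-distrib-* (- iQ) d n) ⟩
    a * ((- iQ) ^ℚ n * d ^ℚ n)
      ≡⟨ rearrange a ((- iQ) ^ℚ n) (d ^ℚ n) ⟩
    (- iQ) ^ℚ n * a * d ^ℚ n
      ≡⟨ cong₂ (λ x y → x * a * y) (inv-⟦-⟧^ n q≢0) d^n≡UG ⟨
    inv (⟦ ℤ.- q ⟧ ^ℚ n) * a * ⟦ UG p q n ((suc m ℕ.+ 2) ℕ.* n) ⟧
      ∎
    where
    n = suc j
    a = u (suc m)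
    b = u (suc (suc m))
    d = u (suc (suc (suc m)))
    iQ = inv Q
    r = ⟦ ℤ.- p ⟧ * iQ
    -x*y*b+a≡a-x*y*b : ∀ x y b a → (- x) * y * b + a ≡ a - x * y * b
    -x*y*b+a≡a-x*y*b = solve-∀ ℚ-ring
    rearrange : ∀ a x y → a * (x * y) ≡ x * a * y
    rearrange = solve-∀ ℚ-ring
    r*b+a≡-iQ*d : r * b + a ≡ (- iQ) * d
    r*b+a≡-iQ*d = begin
      ⟦ ℤ.- p ⟧ * iQ * b + a     ≡⟨ cong (λ x → x * iQ * b + a) (⟦⟧-homo‿- p) ⟩
      (- P) * iQ * b + a         ≡⟨ -x*y*b+a≡a-x*y*b P iQ b a ⟩
      a - P * iQ * b             ≡⟨ u-ascend m (inv-inverseˡ (⟦⟧-≢0 q≢0)) ⟩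
      (- iQ) * d                 ∎
    d^n≡UG : ⟦ UG p q n ((suc m ℕ.+ 2) ℕ.* n) ⟧ ≡ d ^ℚ n
    d^n≡UG = trans (⟦UG⟧-multiple j (suc m ℕ.+ 2)) (cong (λ i → u i ^ℚ n) (ℕ.+-comm (suc m) 2))

  identity-iii : ∀ n m → p ≢ ℤ.0ℤ → q ≢ ℤ.0ℤ → U p q m ≢ ℤ.0ℤ → let k = suc n in
    Σ< k (λ t → inv (P ^ℚ t) * ⟦ UG p q k (suc m ℕ.* k ℕ.+ t) ⟧)
      ≡ (- (P * inv Q)) * inv (P ^ℚ k) * (u (suc m) * inv (u m))
        * (⟦ UG p q k (suc (suc m) ℕ.* k) ⟧ - P ^ℚ k * ⟦ UG p q k (suc m ℕ.* k) ⟧)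
  identity-iii n m p≢0 q≢0 c≢0 = begin
    Σ< k (λ t → inv (P ^ℚ t) * UGₜ t)
      ≡⟨ Σ<-cong k (λ t _ → cong (_* UGₜ t) (inv-^ t P≢0)) ⟩
    S
      ≡⟨ *-inverse-move S*d≡a*[A-X] d*d⁻¹≡1 ⟩
    a * (A - X) * d⁻¹
      ≡⟨ cong (λ e → a * (A - e) * d⁻¹) (^ℚ-distrib-* iP b k) ⟩
    a * (A - Iₖ * B) * d⁻¹
      ≡⟨ expand P iQ a ic A B Iₖ Pₖ ⟩
    R + (1ℚ - Iₖ * Pₖ) * (P * iQ * a * ic * A)
      ≡⟨ absorb-unit R (P * iQ * a * ic * A) (^ℚ-inverse {P} {iP} k iP*P≡1) ⟩
    (- (P * iQ)) * Iₖ * (a * ic) * (B - Pₖ * A)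
      ≡⟨ cong (λ x → (- (P * iQ)) * x * (a * ic) * (B - Pₖ * A)) (inv-^ k P≢0) ⟨
    (- (P * iQ)) * inv Pₖ * (a * ic) * (B - Pₖ * A)
      ≡⟨ cong₂ (λ y z → (- (P * iQ)) * inv Pₖ * (a * ic) * (y - Pₖ * z))
               (⟦UG⟧-multiple n (suc (suc m))) (⟦UG⟧-multiple n (suc m)) ⟨
    (- (P * iQ)) * inv Pₖ * (a * ic) * (⟦ UG p q k (suc (suc m) ℕ.* k) ⟧ - Pₖ * ⟦ UG p q k (suc m ℕ.* k) ⟧)
      ∎
    where
    k = suc n
    a = u (suc m)
    b = u (suc (suc m))
    c = u m
    iP = inv P
    iQ = inv Q
    ic = inv c
    P≢0 = ⟦⟧-≢0 p≢0
    iP*P≡1 = inv-inverseˡ P≢0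
    UGₜ : ℕ → ℚ
    UGₜ t = ⟦ UG p q k (suc m ℕ.* k ℕ.+ t) ⟧
    S = Σ< k (λ t → iP ^ℚ t * UGₜ t)
    A = a ^ℚ k
    B = b ^ℚ k
    X = (iP * b) ^ℚ k
    Iₖ = iP ^ℚ k
    Pₖ = P ^ℚ k
    R = (- (P * iQ)) * Iₖ * (a * ic) * (B - Pₖ * A)
    d = Q * iP * c
    d⁻¹ = P * iQ * ic
    S*d≡a*[A-X] : S * d ≡ a * (A - X)
    S*d≡a*[A-X] = trans (cong (S *_) (sym (u-descend m iP*P≡1))) (Σ<-geometric-UG n (suc m) iP)
    regroup : ∀ x ix y iy z iz → y * ix * z * (x * iy * iz) ≡ ix * x * (iy * y) * (iz * z)
    regroup = solve-∀ ℚ-ring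
    d*d⁻¹≡1 : d * d⁻¹ ≡ 1ℚ
    d*d⁻¹≡1 = trans (regroup P iP Q iQ c ic)
                    (cong₂ _*_ (cong₂ _*_ iP*P≡1 (inv-inverseˡ (⟦⟧-≢0 q≢0))) (inv-inverseˡ (⟦⟧-≢0 c≢0)))
    expand : ∀ P iQ a ic A B Iₖ Pₖ → a * (A - Iₖ * B) * (P * iQ * ic)
             ≡ (- (P * iQ)) * Iₖ * (a * ic) * (B - Pₖ * A) + (1ℚ - Iₖ * Pₖ) * (P * iQ * a * ic * A)
    expand = solve-∀ ℚ-ring

theorem2 : (p q : ℤ) → p ≢ ℤ.0ℤ → q ≢ ℤ.0ℤ → (p ℤ.* p ℤ.- ℤ.+ 4 ℤ.* q) ≢ ℤ.0ℤ →
    (k m : ℕ) → 2 ≤ k → 1 ≤ m →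
    (Σ< k (λ t → ⟦ ℤ.+ ((k ∸ 1) C t) ⟧ * inv (⟦ ℤ.- p ⟧ ^ℚ t) * ⟦ UG p q k (m ℕ.* k ℕ.+ t) ⟧)
       ≡ ((⟦ q ⟧ * inv ⟦ p ⟧) ^ℚ (k ∸ 1)) * ⟦ U p q m ⟧ * ⟦ UG p q (k ∸ 1) ((m ∸ 1) ℕ.* (k ∸ 1)) ⟧)
    × (Σ< k (λ t → ⟦ ℤ.+ ((k ∸ 1) C t) ⟧ * ((⟦ ℤ.- p ⟧ * inv ⟦ q ⟧) ^ℚ t) * ⟦ UG p q k (m ℕ.* k ℕ.+ t) ⟧)
       ≡ inv (⟦ ℤ.- q ⟧ ^ℚ (k ∸ 1)) * ⟦ U p q m ⟧ * ⟦ UG p q (k ∸ 1) ((m ℕ.+ 2) ℕ.* (k ∸ 1)) ⟧)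
    × (U p q (m ∸ 1) ≢ ℤ.0ℤ →
       Σ< k (λ t → inv (⟦ p ⟧ ^ℚ t) * ⟦ UG p q k (m ℕ.* k ℕ.+ t) ⟧)
       ≡ (- (⟦ p ⟧ * inv ⟦ q ⟧)) * inv (⟦ p ⟧ ^ℚ k) * (⟦ U p q m ⟧ * inv ⟦ U p q (m ∸ 1) ⟧)
         * (⟦ UG p q k (suc m ℕ.* k) ⟧ - (⟦ p ⟧ ^ℚ k) * ⟦ UG p q k (m ℕ.* k) ⟧))
theorem2 p q p≢0 q≢0 _ (suc (suc j)) (suc m) (s≤s (s≤s z≤n)) (s≤s z≤n) =
  identity-i p q j m p≢0 , identity-ii p q j m q≢0 , identity-iii p q (suc j) m p≢0 q≢0
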